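{- Let $G$ be a finite group of order $v$ containing a regular $(v,k,\lambda,\mu)$-partial difference set, where $0<\mu<k$ and $\Delta=(\lambda-\mu)^2+4(k-\mu)$ is a perfect square; put $\theta_1=\frac12(\lambda-\mu+\sqrt\Delta)$, $\theta_2=\frac12(\lambda-\mu-\sqrt\Delta)$. Suppose $p$ is a prime dividing $v$ but not $\sqrt\Delta$. Then there exists a factorization $\mu=\mu_1\mu_2$ into positive integers such that $v_1=(k-\theta_1)/\mu_1$ and $v_2=(k-\theta_2)/\mu_2$ are integers, $v=v_1v_2$, and $p$ divides exactly one of $v_1,v_2$.
   Context: A subset $D$ of a finite group $G$ of order $v$ with $|D|=k$ is a $(v,k,\lambda,\mu)$-partial difference set if every nonidentity element of $D$ can be written as $xy^{ -1}$ with $x,y\in D$ in exactly $\lambda$ ways, and every nonidentity element of $G\setminus D$ in exactly $\mu$ ways; it is regular if $D=\{d^{ -1}:d\in D\}$ and $1\notin D$. -}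

module Defs where

open import Data.Nat using (ℕ; zero; suc)
open import Data.Fin using (Fin; _≟_)
open import Data.List using (List; map; allFin)
open import Data.Nat.ListAction using (sum)
open import Data.Bool using (Bool; true; false; if_then_else_; _∧_)
open import Relation.Nullary.Decidable using (⌊_⌋)
open import Relation.Binary.PropositionalEquality using (_≡_; _≢_)

-- A finite group of order v, presented on the carrier Fin v
-- (every finite group of order v is isomorphic to such a one).
record FinGroup (v : ℕ) : Set where
  field
    _·_     : Fin v → Fin v → Fin v
    e       : Fin v
    inv     : Fin v → Fin v
    assoc   : ∀ x y z → (x · y) · z ≡ x · (y · z)
    identˡ  : ∀ x → e · x ≡ x
    identʳ  : ∀ x → x · e ≡ x
    inverseˡ : ∀ x → inv x · x ≡ e
    inverseʳ : ∀ x → x · inv x ≡ e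

open FinGroup public

Subset : ℕ → Set
Subset v = Fin v → Bool

card : ∀ {v} → Subset v → ℕ
card {v} D = sum (map (λ x → if D x then 1 else 0) (allFin v))

diffCount : ∀ {v} → FinGroup v → Subset v → Fin v → ℕ
diffCount {v} G D g =
  sum (map (λ x → sum (map (λ y →
        if D x ∧ D y ∧ ⌊ (_·_ G x (inv G y)) ≟ g ⌋ then 1 else 0)
      (allFin v))) (allFin v))

IsPDS : ∀ {v} → FinGroup v → Subset v → ℕ → ℕ → ℕ → Set
IsPDS {v} G D k lam mu =
  card D ≡ k
  × (∀ g → g ≢ e G → D g ≡ true  → diffCount G D g ≡ lam)
  × (∀ g → g ≢ e G → D g ≡ false → diffCount G D g ≡ mu)
  where open import Data.Product using (_×_)

IsRegular : ∀ {v} → FinGroup v → Subset v → Set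
IsRegular G D = (∀ d → D (inv G d) ≡ D d) × (D (e G) ≡ false)
  where open import Data.Product using (_×_)

{-# OPTIONS --safe #-}
module Submission where

-- Counting the pairs (x , y) ∈ D × D by their quotient x y⁻¹ gives
-- k² = k + λk + μ(v − 1 − k). With c = 2k − (λ − μ) this reads (c − s)(c + s) = c² − Δ = 4μv,
-- i.e. (k − θ₁)(k − θ₂) = μv, where k − θ₁ and k − θ₂ are integers because c − s and c + s
-- have even sum and even product, hence are both even. Splitting μ = μ₁μ₂ with μ₁ ∣ k − θ₁
-- and μ₂ ∣ k − θ₂ gives v = v₁v₂, and a prime dividing both vᵢ would divide
-- (k − θ₂) − (k − θ₁) = s.

module DifferenceCounting where

  open import Defs
  open import Data.Nat.Properties using (+-*-semiring; +-identityʳ; *-identityʳ; *-zeroʳ)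
  open import Algebra.Properties.Semiring.Sum +-*-semiring
    using (sum-syntax; sum-cong-≗; sum-replicate-zero; ∑-comm; ∑-distrib-+;
           *-distribˡ-sum; *-distribʳ-sum)
  open import Data.Bool using (Bool; true; false; if_then_else_; _∧_)
  open import Data.Bool.Properties using (∧-idem)
  open import Data.Fin using (Fin; zero; suc; _≟_)
  open import Data.List using ([]; _∷_; map; allFin; tabulate)
  open import Data.List.Properties using (map-tabulate)
  import Data.Nat.ListAction as List
  open import Data.Nat using (ℕ; zero; suc; _+_; _*_)
  open import Data.Nat.Tactic.RingSolver using (solve)
  open import Data.Product using (_,_)
  open import Function using (_⇔_; mk⇔; _∘_)
  open import Relation.Nullary.Decidable
    using (Dec; yes; no; ⌊_⌋; ⌊⌋-map′; does-⇔; isYes≗does)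
  open import Relation.Binary.PropositionalEquality
  open ≡-Reasoning

  𝟙 : Bool → ℕ
  𝟙 b = if b then 1 else 0

  𝟙-∧ : ∀ a b → 𝟙 (a ∧ b) ≡ 𝟙 a * 𝟙 b
  𝟙-∧ true  b = sym (+-identityʳ (𝟙 b))
  𝟙-∧ false b = refl

  𝟙-∧-∧ : ∀ a b c → 𝟙 (a ∧ b ∧ c) ≡ 𝟙 c * 𝟙 (a ∧ b)
  𝟙-∧-∧ true  true  c = sym (*-identityʳ (𝟙 c))
  𝟙-∧-∧ true  false c = sym (*-zeroʳ (𝟙 c))
  𝟙-∧-∧ false b     c = sym (*-zeroʳ (𝟙 c))

  ⌊⌋-⇔ : ∀ {A B : Set} → A ⇔ B → (a? : Dec A) (b? : Dec B) → ⌊ a? ⌋ ≡ ⌊ b? ⌋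
  ⌊⌋-⇔ A⇔B a? b? = trans (isYes≗does a?) (trans (does-⇔ A⇔B a? b?) (sym (isYes≗does b?)))

  sum-tabulate : ∀ {n} (f : Fin n → ℕ) → List.sum (tabulate f) ≡ ∑[ i < n ] f i
  sum-tabulate {zero}  f = refl
  sum-tabulate {suc n} f = cong (f zero +_) (sum-tabulate (f ∘ suc))

  sum-allFin : ∀ {n} (f : Fin n → ℕ) → List.sum (map f (allFin n)) ≡ ∑[ i < n ] f i
  sum-allFin f = trans (cong List.sum (map-tabulate (λ i → i) f)) (sum-tabulate f)

  ∑-const : ∀ n c → ∑[ i < n ] c ≡ n * c
  ∑-const zero    c = refl
  ∑-const (suc n) c = cong (c +_) (∑-const n c)

  ∑-distrib-+₃ : ∀ {n} (f g h : Fin n → ℕ) →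
    ∑[ i < n ] (f i + g i + h i) ≡ ∑[ i < n ] f i + ∑[ i < n ] g i + ∑[ i < n ] h i
  ∑-distrib-+₃ f g h =
    trans (∑-distrib-+ (λ i → f i + g i) h) (cong (_+ ∑[ i < _ ] h i) (∑-distrib-+ f g))

  ∑-𝟙-≟ : ∀ {n} (i : Fin n) (f : Fin n → ℕ) → ∑[ j < n ] (𝟙 ⌊ i ≟ j ⌋ * f j) ≡ f i
  ∑-𝟙-≟ {suc n} zero    f =
    trans (cong₂ _+_ (+-identityʳ (f zero)) (sum-replicate-zero n)) (+-identityʳ (f zero))
  ∑-𝟙-≟ {suc n} (suc i) f = trans
    (sum-cong-≗ (λ j → cong (λ b → 𝟙 b * f (suc j)) (⌊⌋-map′ _ _ (i ≟ j))))
    (∑-𝟙-≟ i (f ∘ suc))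

  module _ {v : ℕ} (G : FinGroup v) (D : Subset v) where
    open FinGroup G using () renaming (_·_ to infixl 7 _∙_; e to ε; inv to infix 8 _⁻¹)

    card≡∑ : card D ≡ ∑[ x < v ] 𝟙 (D x)
    card≡∑ = sum-allFin (λ x → 𝟙 (D x))

    ∑-card-* : ∀ c → ∑[ g < v ] (𝟙 (D g) * c) ≡ card D * c
    ∑-card-* c = trans (sym (*-distribʳ-sum c (λ g → 𝟙 (D g)))) (cong (_* c) (sym card≡∑))

    ∑∑𝟙-∧≡card² : ∑[ x < v ] ∑[ y < v ] 𝟙 (D x ∧ D y) ≡ card D * card D
    ∑∑𝟙-∧≡card² = begin
      ∑[ x < v ] ∑[ y < v ] 𝟙 (D x ∧ D y)
        ≡⟨ sum-cong-≗ (λ x → sum-cong-≗ (λ y → 𝟙-∧ (D x) (D y))) ⟩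
      ∑[ x < v ] ∑[ y < v ] (𝟙 (D x) * 𝟙 (D y))
        ≡⟨ sum-cong-≗ (λ x → *-distribˡ-sum (𝟙 (D x)) (λ y → 𝟙 (D y))) ⟨
      ∑[ x < v ] (𝟙 (D x) * ∑[ y < v ] 𝟙 (D y))
        ≡⟨ *-distribʳ-sum (∑[ y < v ] 𝟙 (D y)) (λ x → 𝟙 (D x)) ⟨
      ∑[ x < v ] 𝟙 (D x) * ∑[ y < v ] 𝟙 (D y)
        ≡⟨ cong₂ _*_ card≡∑ card≡∑ ⟨
      card D * card D ∎

    diffTerm : Fin v → Fin v → Fin v → ℕ
    diffTerm x y g = 𝟙 (D x ∧ D y ∧ ⌊ x ∙ y ⁻¹ ≟ g ⌋)

    diffCount≡∑∑ : ∀ g → diffCount G D g ≡ ∑[ x < v ] ∑[ y < v ] diffTerm x y g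
    diffCount≡∑∑ g = trans (sum-allFin (λ x → List.sum (map (λ y → diffTerm x y g) (allFin v))))
                           (sum-cong-≗ (λ x → sum-allFin (λ y → diffTerm x y g)))

    ∑-diffCount : ∑[ g < v ] diffCount G D g ≡ card D * card D
    ∑-diffCount = begin
      ∑[ g < v ] diffCount G D g
        ≡⟨ sum-cong-≗ diffCount≡∑∑ ⟩
      ∑[ g < v ] ∑[ x < v ] ∑[ y < v ] diffTerm x y g
        ≡⟨ ∑-comm (λ g x → ∑[ y < v ] diffTerm x y g) ⟩
      ∑[ x < v ] ∑[ g < v ] ∑[ y < v ] diffTerm x y g
        ≡⟨ sum-cong-≗ (λ x → ∑-comm (λ g y → diffTerm x y g)) ⟩
      ∑[ x < v ] ∑[ y < v ] ∑[ g < v ] diffTerm x y g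
        ≡⟨ sum-cong-≗ (λ x → sum-cong-≗ (sifted x)) ⟩
      ∑[ x < v ] ∑[ y < v ] 𝟙 (D x ∧ D y)
        ≡⟨ ∑∑𝟙-∧≡card² ⟩
      card D * card D ∎
      where
      sifted : ∀ x y → ∑[ g < v ] diffTerm x y g ≡ 𝟙 (D x ∧ D y)
      sifted x y = trans (sum-cong-≗ (λ g → 𝟙-∧-∧ (D x) (D y) ⌊ x ∙ y ⁻¹ ≟ g ⌋))
                         (∑-𝟙-≟ (x ∙ y ⁻¹) (λ _ → 𝟙 (D x ∧ D y)))

    ∙⁻¹≡ε⇔≡ : ∀ x y → (x ∙ y ⁻¹ ≡ ε) ⇔ (x ≡ y)
    ∙⁻¹≡ε⇔≡ x y = mk⇔ cancel (λ { refl → inverseʳ G x })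
      where
      cancel : x ∙ y ⁻¹ ≡ ε → x ≡ y
      cancel x∙y⁻¹≡ε = begin
        x                ≡⟨ identʳ G x ⟨
        x ∙ ε            ≡⟨ cong (x ∙_) (inverseˡ G y) ⟨
        x ∙ (y ⁻¹ ∙ y)   ≡⟨ assoc G x (y ⁻¹) y ⟨
        x ∙ y ⁻¹ ∙ y     ≡⟨ cong (_∙ y) x∙y⁻¹≡ε ⟩
        ε ∙ y            ≡⟨ identˡ G y ⟩
        y                ∎

    diffCount-ε : diffCount G D ε ≡ card D
    diffCount-ε = begin
      diffCount G D ε
        ≡⟨ diffCount≡∑∑ ε ⟩
      ∑[ x < v ] ∑[ y < v ] diffTerm x y ε
        ≡⟨ sum-cong-≗ (λ x → sum-cong-≗ (on-diagonal x)) ⟩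
      ∑[ x < v ] ∑[ y < v ] (𝟙 ⌊ x ≟ y ⌋ * 𝟙 (D x ∧ D y))
        ≡⟨ sum-cong-≗ (λ x → ∑-𝟙-≟ x (λ y → 𝟙 (D x ∧ D y))) ⟩
      ∑[ x < v ] 𝟙 (D x ∧ D x)
        ≡⟨ sum-cong-≗ (λ x → cong 𝟙 (∧-idem (D x))) ⟩
      ∑[ x < v ] 𝟙 (D x)
        ≡⟨ card≡∑ ⟨
      card D ∎
      where
      on-diagonal : ∀ x y → diffTerm x y ε ≡ 𝟙 ⌊ x ≟ y ⌋ * 𝟙 (D x ∧ D y)
      on-diagonal x y = trans (𝟙-∧-∧ (D x) (D y) ⌊ x ∙ y ⁻¹ ≟ ε ⌋)
        (cong (λ b → 𝟙 b * 𝟙 (D x ∧ D y)) (⌊⌋-⇔ (∙⁻¹≡ε⇔≡ x y) (x ∙ y ⁻¹ ≟ ε) (x ≟ y)))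

    -- k (k − λ − 1) = μ (v − k − 1), with the subtractions moved across.
    pds-counting : ∀ {k lam mu} → IsPDS G D k lam mu → D ε ≡ false →
      k * k + mu + k * mu ≡ k + k * lam + v * mu
    pds-counting {k} {lam} {mu} (|D|≡k , onD , offD) ε∉D = begin
      k * k + mu + k * mu
        ≡⟨ cong₂ _+_ (cong₂ _+_ (trans ∑-diffCount (cong₂ _*_ |D|≡k |D|≡k)) (∑-𝟙-≟ ε (λ _ → mu)))
                     (trans (∑-card-* mu) (cong (_* mu) |D|≡k)) ⟨
      ∑[ g < v ] diffCount G D g + ∑[ g < v ] (𝟙 ⌊ ε ≟ g ⌋ * mu) + ∑[ g < v ] (𝟙 (D g) * mu)
        ≡⟨ ∑-distrib-+₃ (diffCount G D) (λ g → 𝟙 ⌊ ε ≟ g ⌋ * mu) (λ g → 𝟙 (D g) * mu) ⟨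
      ∑[ g < v ] (diffCount G D g + 𝟙 ⌊ ε ≟ g ⌋ * mu + 𝟙 (D g) * mu)
        ≡⟨ sum-cong-≗ pointwise ⟩
      ∑[ g < v ] (𝟙 ⌊ ε ≟ g ⌋ * k + 𝟙 (D g) * lam + mu)
        ≡⟨ ∑-distrib-+₃ (λ g → 𝟙 ⌊ ε ≟ g ⌋ * k) (λ g → 𝟙 (D g) * lam) (λ _ → mu) ⟩
      ∑[ g < v ] (𝟙 ⌊ ε ≟ g ⌋ * k) + ∑[ g < v ] (𝟙 (D g) * lam) + ∑[ g < v ] mu
        ≡⟨ cong₂ _+_ (cong₂ _+_ (∑-𝟙-≟ ε (λ _ → k)) (trans (∑-card-* lam) (cong (_* lam) |D|≡k)))
                     (∑-const v mu) ⟩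
      k + k * lam + v * mu ∎
      where
      pointwise : ∀ g → diffCount G D g + 𝟙 ⌊ ε ≟ g ⌋ * mu + 𝟙 (D g) * mu
                      ≡ 𝟙 ⌊ ε ≟ g ⌋ * k + 𝟙 (D g) * lam + mu
      pointwise g with ε ≟ g
      ... | yes refl rewrite ε∉D | diffCount-ε | |D|≡k = solve (k ∷ mu ∷ [])
      ... | no ε≢g with D g in Dg
      ...   | true  rewrite onD  g (ε≢g ∘ sym) Dg = solve (lam ∷ mu ∷ [])
      ...   | false rewrite offD g (ε≢g ∘ sym) Dg = solve (mu ∷ [])

module Divisibility where

  import Algebra.Properties.CommutativeSemigroup as CommutativeSemigroupProperties
  open import Data.Integer.Base using (ℤ; +_; _+_; _-_; _*_; ∣_∣)
  open import Data.Integer.Divisibility using (_∣_)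
  import Data.Integer.Divisibility.Signed as Signed
  import Data.Integer.Properties as ℤ
  open import Data.Nat.Base as ℕ using (ℕ; NonZero)
  open import Data.Nat.Coprimality using (Coprime; GCD≡1⇒coprime; coprime-divisor)
  import Data.Nat.Divisibility as ℕ
  open import Data.Nat.GCD using (gcd; GCD; gcd-GCD; gcd[m,n]∣m; gcd[m,n]∣n; gcd[m,n]≡0⇒m≡0; GCD-*)
  open import Data.Nat.Primality using (Prime; prime?; euclidsLemma)
  import Data.Nat.Properties as ℕ
  open import Data.Product using (∃; ∃₂; _×_; _,_)
  open import Data.Sum using (_⊎_; inj₁; inj₂)
  open import Relation.Nullary using (¬_)
  open import Relation.Nullary.Decidable using (from-yes)
  open import Relation.Binary.PropositionalEquality
  open ≡-Reasoning

  module ℕ* = CommutativeSemigroupProperties ℕ.*-commutativeSemigroup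
  module ℤ* = CommutativeSemigroupProperties ℤ.*-commutativeSemigroup

  2-prime : Prime 2
  2-prime = from-yes (prime? 2)

  0<m*n⇒0<m×0<n : ∀ m n → 0 ℕ.< m ℕ.* n → 0 ℕ.< m × 0 ℕ.< n
  0<m*n⇒0<m×0<n m n 0<mn =
    ℕ.>-nonZero⁻¹ m {{ℕ.m*n≢0⇒m≢0 m {{ℕ.>-nonZero 0<mn}}}} ,
    ℕ.>-nonZero⁻¹ n {{ℕ.m*n≢0⇒n≢0 m {{ℕ.>-nonZero 0<mn}}}}

  -- m₁ = gcd m a; then m / m₁ is coprime to a / m₁, so it divides b.
  ∣-*-split : ∀ {m a b} .{{_ : NonZero m}} → m ℕ.∣ a ℕ.* b →
    ∃₂ λ m₁ m₂ → m₁ ℕ.* m₂ ≡ m × m₁ ℕ.∣ a × m₂ ℕ.∣ b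
  ∣-*-split {m} {a} {b} m∣ab with gcd[m,n]∣m m a | gcd[m,n]∣n m a
  ... | ℕ.divides m′ m≡m′g | ℕ.divides a′ a≡a′g =
    g , m′ , trans (ℕ.*-comm g m′) (sym m≡m′g) , gcd[m,n]∣n m a , coprime-divisor m′⊥a′ m′∣a′b
    where
    g = gcd m a
    instance
      g≢0 : NonZero g
      g≢0 = ℕ.≢-nonZero (λ g≡0 → ℕ.≢-nonZero⁻¹ m (gcd[m,n]≡0⇒m≡0 g≡0))
    m′⊥a′ : Coprime m′ a′
    m′⊥a′ = GCD≡1⇒coprime (GCD-* (subst (GCD _ _) (sym (ℕ.*-identityˡ g))
              (subst₂ (λ x y → GCD x y g) m≡m′g a≡a′g (gcd-GCD m a))))
    m′∣a′b : m′ ℕ.∣ a′ ℕ.* b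
    m′∣a′b = ℕ.*-cancelʳ-∣ g
      (subst₂ ℕ._∣_ m≡m′g (trans (cong (ℕ._* b) a≡a′g) (ℕ*.xy∙z≈xz∙y a′ g b)) m∣ab)

  ∣-quotient : ∀ {m} x → (+ m) ∣ x → ∃ λ q → x ≡ + m * q
  ∣-quotient {m} x m∣x with Signed.∣ᵤ⇒∣ {+ m} {x} m∣x
  ... | Signed.divides q x≡qm = q , trans x≡qm (ℤ.*-comm q (+ m))

  m∣m*n : ∀ m x → (+ m) ∣ + m * x
  m∣m*n m x = Signed.∣⇒∣ᵤ {+ m} (Signed.∣m⇒∣m*n x Signed.∣-refl)

  ∣m∣n⇒∣am-bn : ∀ {d} a m b n → (+ d) ∣ m → (+ d) ∣ n → (+ d) ∣ + a * m - + b * n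
  ∣m∣n⇒∣am-bn {d} a m b n d∣m d∣n = Signed.∣⇒∣ᵤ {+ d} (Signed.∣m∣n⇒∣m-n
    (Signed.∣n⇒∣m*n (+ a) (Signed.∣ᵤ⇒∣ {+ d} {m} d∣m))
    (Signed.∣n⇒∣m*n (+ b) (Signed.∣ᵤ⇒∣ {+ d} {n} d∣n)))

  prime∣*⇒∣⊎∣ : ∀ {p} → Prime p → ∀ x y → (+ p) ∣ x * y → ((+ p) ∣ x) ⊎ ((+ p) ∣ y)
  prime∣*⇒∣⊎∣ {p} p-prime x y p∣xy =
    euclidsLemma ∣ x ∣ ∣ y ∣ p-prime (subst (p ℕ.∣_) (ℤ.abs-* x y) p∣xy)

  prime∣*⇒exactly-one : ∀ {p} → Prime p → ∀ x y → (+ p) ∣ x * y → ¬ (((+ p) ∣ x) × ((+ p) ∣ y)) →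
    (((+ p) ∣ x) × ¬ ((+ p) ∣ y)) ⊎ (¬ ((+ p) ∣ x) × ((+ p) ∣ y))
  prime∣*⇒exactly-one p-prime x y p∣xy ¬both with prime∣*⇒∣⊎∣ p-prime x y p∣xy
  ... | inj₁ p∣x = inj₁ (p∣x , λ p∣y → ¬both (p∣x , p∣y))
  ... | inj₂ p∣y = inj₂ ((λ p∣x → ¬both (p∣x , p∣y)) , p∣y)

  prime∣+×∣*⇒∣×∣ : ∀ {p} → Prime p → ∀ x y → (+ p) ∣ x + y → (+ p) ∣ x * y →
    ((+ p) ∣ x) × ((+ p) ∣ y)
  prime∣+×∣*⇒∣×∣ {p} p-prime x y p∣x+y p∣xy with prime∣*⇒∣⊎∣ p-prime x y p∣xy
  ... | inj₁ p∣x =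
    p∣x , Signed.∣⇒∣ᵤ (Signed.∣m+n∣m⇒∣n {+ p} {x} (Signed.∣ᵤ⇒∣ p∣x+y) (Signed.∣ᵤ⇒∣ p∣x))
  ... | inj₂ p∣y =
    Signed.∣⇒∣ᵤ (Signed.∣m+n∣n⇒∣m {+ p} {x} (Signed.∣ᵤ⇒∣ p∣x+y) (Signed.∣ᵤ⇒∣ p∣y)) , p∣y

  record ProductSplit (m n : ℕ) (a b : ℤ) : Set where
    field
      m₁ m₂   : ℕ
      n₁ n₂   : ℤ
      m₁*m₂≡m : m₁ ℕ.* m₂ ≡ m
      a≡m₁*n₁ : a ≡ + m₁ * n₁
      b≡m₂*n₂ : b ≡ + m₂ * n₂
      n≡n₁*n₂ : + n ≡ n₁ * n₂

  product-split : ∀ m .{{_ : NonZero m}} n a b → a * b ≡ + (m ℕ.* n) → ProductSplit m n a b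
  product-split m n a b ab≡mn
    with ∣-*-split (subst (m ℕ.∣_) (trans (cong ∣_∣ (sym ab≡mn)) (ℤ.abs-* a b)) (ℕ.m∣m*n n))
  ... | m₁ , m₂ , m₁m₂≡m , m₁∣a , m₂∣b with ∣-quotient a m₁∣a | ∣-quotient b m₂∣b
  ... | n₁ , a≡m₁n₁ | n₂ , b≡m₂n₂ = record
    { m₁      = m₁
    ; m₂      = m₂
    ; n₁      = n₁
    ; n₂      = n₂
    ; m₁*m₂≡m = m₁m₂≡m
    ; a≡m₁*n₁ = a≡m₁n₁
    ; b≡m₂*n₂ = b≡m₂n₂
    ; n≡n₁*n₂ = ℤ.*-cancelˡ-≡ (+ m) (+ n) (n₁ * n₂) (begin
        + m * + n                   ≡⟨ ℤ.pos-* m n ⟨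
        + (m ℕ.* n)                 ≡⟨ ab≡mn ⟨
        a * b                       ≡⟨ cong₂ _*_ a≡m₁n₁ b≡m₂n₂ ⟩
        (+ m₁ * n₁) * (+ m₂ * n₂)   ≡⟨ ℤ*.interchange (+ m₁) n₁ (+ m₂) n₂ ⟩
        (+ m₁ * + m₂) * (n₁ * n₂)   ≡⟨ cong (_* (n₁ * n₂)) +m₁*+m₂≡+m ⟩
        + m * (n₁ * n₂)             ∎)
    }
    where
    +m₁*+m₂≡+m : + m₁ * + m₂ ≡ + m
    +m₁*+m₂≡+m = trans (sym (ℤ.pos-* m₁ m₂)) (cong +_ m₁m₂≡m)

open import Defs
open import Data.Nat using (ℕ; _<_)
open import Data.Nat.Primality using (Prime)
open import Data.Product using (Σ; _×_; ∃)
open import Data.Sum using (_⊎_)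
open import Relation.Nullary using (¬_)
open import Relation.Binary.PropositionalEquality using (_≡_)
open import Data.Integer using (ℤ; +_; _+_; _-_; _*_)
open import Data.Integer.Divisibility using (_∣_)

import Data.Nat as ℕ
import Data.Integer.Properties as ℤ
open import Data.Integer.Tactic.RingSolver using (solve-∀)
open import Data.Product using (_,_; proj₁; proj₂)
open import Relation.Binary.PropositionalEquality using (sym; trans; cong; cong₂; subst; module ≡-Reasoning)
open DifferenceCounting using (pds-counting)
open Divisibility

-- gapᵢ = k − θᵢ, where θ₁ , θ₂ = (λ − μ ± s) / 2.
record EigenvalueGaps (v k lam mu s : ℕ) : Set where
  field
    gap₁ gap₂    : ℤ
    twice-gap₁   : (+ 2) * (+ k) - ((+ lam) - (+ mu) + (+ s)) ≡ (+ 2) * gap₁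
    twice-gap₂   : (+ 2) * (+ k) - ((+ lam) - (+ mu) - (+ s)) ≡ (+ 2) * gap₂
    gap₁*gap₂≡μv : gap₁ * gap₂ ≡ + (mu ℕ.* v)
    gap₂-gap₁≡s  : gap₂ - gap₁ ≡ + s

eigenvalue-gaps : ∀ v k lam mu s →
  k ℕ.* k ℕ.+ mu ℕ.+ k ℕ.* mu ≡ k ℕ.+ k ℕ.* lam ℕ.+ v ℕ.* mu →
  (+ s) * (+ s) ≡ ((+ lam) - (+ mu)) * ((+ lam) - (+ mu)) + (+ 4) * ((+ k) - (+ mu)) →
  EigenvalueGaps v k lam mu s
eigenvalue-gaps v k lam mu s counting s²≡Δ = record
  { gap₁         = proj₁ A/2
  ; gap₂         = proj₁ B/2
  ; twice-gap₁   = proj₂ A/2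
  ; twice-gap₂   = proj₂ B/2
  ; gap₁*gap₂≡μv = ab≡μv (proj₂ A/2) (proj₂ B/2)
  ; gap₂-gap₁≡s  = b-a≡s (proj₂ A/2) (proj₂ B/2)
  }
  where
  open ≡-Reasoning
  K = + k
  L = + lam
  M = + mu
  V = + v
  S = + s
  A = (+ 2) * K - (L - M + S)
  B = (+ 2) * K - (L - M - S)

  counting-ℤ : K * K + M + K * M ≡ K + K * L + V * M
  counting-ℤ = begin
    K * K + M + K * M                 ≡⟨ cong₂ (λ x y → x + M + y) (ℤ.pos-* k k) (ℤ.pos-* k mu) ⟨
    + (k ℕ.* k ℕ.+ mu ℕ.+ k ℕ.* mu)   ≡⟨ cong +_ counting ⟩
    + (k ℕ.+ k ℕ.* lam ℕ.+ v ℕ.* mu)  ≡⟨ cong₂ (λ x y → K + x + y) (ℤ.pos-* k lam) (ℤ.pos-* v mu) ⟩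
    K + K * L + V * M                 ∎

  AB≡4μv : A * B ≡ + 4 * + (mu ℕ.* v)
  AB≡4μv = begin
    A * B
      ≡⟨ expand K L M S ⟩
    + 4 * ((K * K + M + K * M) - (K + K * L)) + ((L - M) * (L - M) + + 4 * (K - M) - S * S)
      ≡⟨ cong₂ (λ x y → + 4 * (x - (K + K * L)) + (y - S * S)) (sym counting-ℤ) s²≡Δ ⟨
    + 4 * ((K + K * L + V * M) - (K + K * L)) + (S * S - S * S)
      ≡⟨ cancel (K + K * L) (V * M) S ⟩
    + 4 * (V * M)
      ≡⟨ cong (+ 4 *_) (trans (ℤ.pos-* mu v) (ℤ.*-comm M V)) ⟨
    + 4 * + (mu ℕ.* v) ∎
    where
    expand : ∀ K L M S → ((+ 2) * K - (L - M + S)) * ((+ 2) * K - (L - M - S)) ≡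
      + 4 * ((K * K + M + K * M) - (K + K * L)) + ((L - M) * (L - M) + + 4 * (K - M) - S * S)
    expand = solve-∀
    cancel : ∀ P Q S → + 4 * ((P + Q) - P) + (S * S - S * S) ≡ + 4 * Q
    cancel = solve-∀

  2∣A×2∣B : ((+ 2) ∣ A) × ((+ 2) ∣ B)
  2∣A×2∣B = prime∣+×∣*⇒∣×∣ 2-prime A B
    (subst ((+ 2) ∣_) (sym (A+B≡2c K L M S)) (m∣m*n 2 ((+ 2) * K - (L - M))))
    (subst ((+ 2) ∣_) (sym (trans AB≡4μv (ℤ.*-assoc (+ 2) (+ 2) (+ (mu ℕ.* v)))))
      (m∣m*n 2 (+ 2 * + (mu ℕ.* v))))
    where
    A+B≡2c : ∀ K L M S →
      ((+ 2) * K - (L - M + S)) + ((+ 2) * K - (L - M - S)) ≡ + 2 * ((+ 2) * K - (L - M))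
    A+B≡2c = solve-∀

  A/2 : ∃ λ a → A ≡ + 2 * a
  A/2 = ∣-quotient A (proj₁ 2∣A×2∣B)

  B/2 : ∃ λ b → B ≡ + 2 * b
  B/2 = ∣-quotient B (proj₂ 2∣A×2∣B)

  ab≡μv : ∀ {a b} → A ≡ + 2 * a → B ≡ + 2 * b → a * b ≡ + (mu ℕ.* v)
  ab≡μv {a} {b} A≡2a B≡2b = ℤ.*-cancelˡ-≡ (+ 4) (a * b) (+ (mu ℕ.* v)) (begin
    + 4 * (a * b)           ≡⟨ ℤ*.interchange (+ 2) a (+ 2) b ⟨
    (+ 2 * a) * (+ 2 * b)   ≡⟨ cong₂ _*_ A≡2a B≡2b ⟨
    A * B                   ≡⟨ AB≡4μv ⟩
    + 4 * + (mu ℕ.* v)      ∎)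

  b-a≡s : ∀ {a b} → A ≡ + 2 * a → B ≡ + 2 * b → b - a ≡ S
  b-a≡s {a} {b} A≡2a B≡2b = ℤ.*-cancelˡ-≡ (+ 2) (b - a) S (begin
    + 2 * (b - a)           ≡⟨ 2*-distrib-- b a ⟩
    + 2 * b - + 2 * a       ≡⟨ cong₂ _-_ B≡2b A≡2a ⟨
    B - A                   ≡⟨ B-A≡2S K L M S ⟩
    + 2 * S                 ∎)
    where
    B-A≡2S : ∀ K L M S → ((+ 2) * K - (L - M - S)) - ((+ 2) * K - (L - M + S)) ≡ + 2 * S
    B-A≡2S = solve-∀
    2*-distrib-- : ∀ x y → + 2 * (x - y) ≡ + 2 * x - + 2 * y
    2*-distrib-- = solve-∀

lemma3p6 : (v k lam mu : ℕ) (G : FinGroup v) (D : Subset v) →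
    IsPDS G D k lam mu → IsRegular G D →
    0 < mu → mu < k →
    (s : ℕ) →
    (+ s) * (+ s) ≡ ((+ lam) - (+ mu)) * ((+ lam) - (+ mu)) + (+ 4) * ((+ k) - (+ mu)) →
    (p : ℕ) → Prime p → (+ p) ∣ (+ v) → ¬ ((+ p) ∣ (+ s)) →
    Σ ℕ λ mu1 → Σ ℕ λ mu2 → Σ ℤ λ v1 → Σ ℤ λ v2 →
      0 < mu1 × 0 < mu2 × mu1 Data.Nat.* mu2 ≡ mu
      × (+ 2) * (+ k) - ((+ lam) - (+ mu) + (+ s)) ≡ (+ 2) * (+ mu1) * v1
      × (+ 2) * (+ k) - ((+ lam) - (+ mu) - (+ s)) ≡ (+ 2) * (+ mu2) * v2
      × (+ v) ≡ v1 * v2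
      × (((+ p) ∣ v1 × ¬ ((+ p) ∣ v2)) ⊎ (¬ ((+ p) ∣ v1) × (+ p) ∣ v2))
lemma3p6 v k lam mu G D pds (_ , e∉D) 0<mu _ s s²≡Δ p p-prime p∣v p∤s =
  m₁ , m₂ , n₁ , n₂ , proj₁ 0<m₁×0<m₂ , proj₂ 0<m₁×0<m₂ , m₁*m₂≡m
  , trans twice-gap₁ (trans (cong ((+ 2) *_) a≡m₁*n₁) (sym (ℤ.*-assoc (+ 2) (+ m₁) n₁)))
  , trans twice-gap₂ (trans (cong ((+ 2) *_) b≡m₂*n₂) (sym (ℤ.*-assoc (+ 2) (+ m₂) n₂)))
  , n≡n₁*n₂
  , prime∣*⇒exactly-one p-prime n₁ n₂ (subst ((+ p) ∣_) n≡n₁*n₂ p∣v) λ (p∣n₁ , p∣n₂) →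
      p∤s (subst ((+ p) ∣_) (trans (cong₂ _-_ (sym b≡m₂*n₂) (sym a≡m₁*n₁)) gap₂-gap₁≡s)
                            (∣m∣n⇒∣am-bn m₂ n₂ m₁ n₁ p∣n₂ p∣n₁))
  where
  instance
    μ≢0 : ℕ.NonZero mu
    μ≢0 = ℕ.>-nonZero 0<mu
  open EigenvalueGaps (eigenvalue-gaps v k lam mu s (pds-counting G D pds e∉D) s²≡Δ)
  open ProductSplit (product-split mu v gap₁ gap₂ gap₁*gap₂≡μv)
  0<m₁×0<m₂ : 0 < m₁ × 0 < m₂
  0<m₁×0<m₂ = 0<m*n⇒0<m×0<n m₁ m₂ (subst (0 <_) (sym m₁*m₂≡m) 0<mu)
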